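{- Let $D=(V,A)$ be a loopless, weakly connected digraph with at least two nodes, let $D'=(V,A')$ be a dicut-equivalent reorientation of $D$, and let $c'$ be the characteristic function of $A'$ on $\overleftrightarrow{A}$. Then $cz=c'z$ for every non-negative circulation $z$ in $\overleftrightarrow{D}$.
   Context: A dicut of $D$ is the set of arcs connecting $Z$ and $V\setminus Z$ for some $Z\subseteq V$ with no arc of $D$ entering $Z$; a dicut-equivalent reorientation of $D$ arises by reversing every arc of some pairwise disjoint dicuts. $\overleftarrow{A}$ is the set of reverses of arcs of $A$, $\overleftrightarrow{A}=A\cup\overleftarrow{A}$ and $\overleftrightarrow{D}=(V,\overleftrightarrow{A})$; each arc of $A'$ is identified with the corresponding arc (original or reversed) of $\overleftrightarrow{A}$. $c$ is the characteristic function of $A$ on $\overleftrightarrow{A}$ ($1$ on $A$, $0$ on $\overleftarrow{A}$). A circulation in $\overleftrightarrow{D}$ is $z:\overleftrightarrow{A}\to\mathbb{R}$ with, at every node, total $z$-value on entering arcs equal to that on leaving arcs; $cz=\sum_e c(e)z(e)$.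
   Formalization: The non-negative circulations z in ↔D take rational values rather than real ones. -}

module Defs where

open import Data.Nat using (ℕ; zero; suc)
open import Data.Fin using (Fin; zero; suc; _≟_)
open import Data.Bool using (Bool; true; false; if_then_else_)
open import Data.Sum using (_⊎_; inj₁; inj₂)
open import Data.Product using (Σ; ∃; _×_; _,_)
open import Data.Rational using (ℚ; 0ℚ; 1ℚ; _+_; _*_; _≤_)
open import Relation.Nullary using (¬_; yes; no; does)
open import Relation.Binary.PropositionalEquality using (_≡_; _≢_)
open import Relation.Binary.Construct.Closure.ReflexiveTransitive using (Star)
open import Function.Bundles using (_⇔_)

record Digraph (n m : ℕ) : Set where
  field
    tail : Fin m → Fin n
    head : Fin m → Fin n
open Digraph public

Loopless : ∀ {n m} → Digraph n m → Set
Loopless {m = m} D = (e : Fin m) → tail D e ≢ head D e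

Adj : ∀ {n m} → Digraph n m → Fin n → Fin n → Set
Adj {m = m} D u v = Σ (Fin m) λ e →
  (tail D e ≡ u × head D e ≡ v) ⊎ (tail D e ≡ v × head D e ≡ u)

WeaklyConnected : ∀ {n m} → Digraph n m → Set
WeaklyConnected {n} D = (u v : Fin n) → Star (Adj D) u v

NodeSet : ℕ → Set
NodeSet n = Fin n → Bool

-- No arc of D enters Z: then the arcs connecting Z and V∖Z form a dicut.
NoArcEnters : ∀ {n m} → Digraph n m → NodeSet n → Set
NoArcEnters {m = m} D Z = (e : Fin m) → Z (head D e) ≡ true → Z (tail D e) ≡ true

-- Arc e connects Z and V∖Z (given no arc enters Z, it leaves Z).
InCut : ∀ {n m} → Digraph n m → NodeSet n → Fin m → Set
InCut D Z e = (Z (tail D e) ≡ true × Z (head D e) ≡ false)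
            ⊎ (Z (tail D e) ≡ false × Z (head D e) ≡ true)

-- D' = (V, A') obtained by reversing exactly the arcs e with  r e ≡ true
-- is a dicut-equivalent reorientation of D: there are pairwise disjoint
-- dicuts (given by Z₀ … Z_{k-1}) whose union is exactly the reversed set.
IsDicutEquivalentReorientation : ∀ {n m} → Digraph n m → (Fin m → Bool) → Set
IsDicutEquivalentReorientation {n} {m} D r =
  Σ ℕ λ k → Σ (Fin k → NodeSet n) λ Zs →
    ((i : Fin k) → NoArcEnters D (Zs i))
  × ((i j : Fin k) → i ≢ j → (e : Fin m) → ¬ (InCut D (Zs i) e × InCut D (Zs j) e))
  × ((e : Fin m) → (r e ≡ true) ⇔ (Σ (Fin k) λ i → InCut D (Zs i) e))

-- The arcs of ↔A: inj₁ e is the original arc e, inj₂ e its reverse.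
BiArc : ℕ → Set
BiArc m = Fin m ⊎ Fin m

biTail : ∀ {n m} → Digraph n m → BiArc m → Fin n
biTail D (inj₁ e) = tail D e
biTail D (inj₂ e) = head D e

biHead : ∀ {n m} → Digraph n m → BiArc m → Fin n
biHead D (inj₁ e) = head D e
biHead D (inj₂ e) = tail D e

Σℚ : (k : ℕ) → (Fin k → ℚ) → ℚ
Σℚ zero    f = 0ℚ
Σℚ (suc k) f = f zero + Σℚ k (λ i → f (suc i))

ΣBi : (m : ℕ) → (BiArc m → ℚ) → ℚ
ΣBi m f = Σℚ m (λ e → f (inj₁ e)) + Σℚ m (λ e → f (inj₂ e))

_·_ : ∀ {m} → (BiArc m → ℚ) → (BiArc m → ℚ) → ℚ
_·_ {m} w z = ΣBi m (λ a → w a * z a)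

inflow : ∀ {n m} → Digraph n m → (BiArc m → ℚ) → Fin n → ℚ
inflow {m = m} D z v = ΣBi m λ a → if does (biHead D a ≟ v) then z a else 0ℚ

outflow : ∀ {n m} → Digraph n m → (BiArc m → ℚ) → Fin n → ℚ
outflow {m = m} D z v = ΣBi m λ a → if does (biTail D a ≟ v) then z a else 0ℚ

IsCirculation : ∀ {n m} → Digraph n m → (BiArc m → ℚ) → Set
IsCirculation {n} D z = (v : Fin n) → inflow D z v ≡ outflow D z v

NonNegative : ∀ {m} → (BiArc m → ℚ) → Set
NonNegative {m} z = (a : BiArc m) → 0ℚ ≤ z a

charA : ∀ {m} → BiArc m → ℚ
charA (inj₁ e) = 1ℚ
charA (inj₂ e) = 0ℚ

-- c' : characteristic function of A' on ↔A, where A' reverses the arcs e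
-- with r e ≡ true (arc e of A' is inj₂ e if reversed, inj₁ e otherwise)
charA' : ∀ {m} → (Fin m → Bool) → BiArc m → ℚ
charA' r (inj₁ e) = if r e then 0ℚ else 1ℚ
charA' r (inj₂ e) = if r e then 1ℚ else 0ℚ

{-# OPTIONS --safe #-}
module Submission where

-- Reversing the arcs of R changes c z by the sum over e ∈ R of z(ē) − z(e).
-- R is a disjoint union of dicuts δ(Z), and over a dicut this sum is the net
-- z-flow into Z, which vanishes for a circulation: weighting the conservation
-- law at every node v by [v ∈ Z] and exchanging the sums over nodes and arcs
-- shows that z-flow leaving Z equals z-flow entering Z.

open import Defs
open import Data.Nat using (ℕ; _≤_; zero; suc)
open import Data.Fin using (Fin; zero; suc; _≟_)
open import Data.Fin.Properties using (punchInᵢ≢i)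
open import Data.Vec.Functional using (removeAt)
open import Data.Bool using (Bool; true; false; if_then_else_; _xor_)
open import Data.Bool.Properties using (¬-not)
open import Data.Rational using (ℚ; 0ℚ; 1ℚ; _+_; _*_)
open import Data.Rational.Properties
  using (+-*-ring; +-0-group; +-0-commutativeMonoid; +-identityʳ; +-assoc;
         *-zeroˡ; *-zeroʳ; *-distribˡ-+; *-distribʳ-+)
open import Data.Sum using (_⊎_; inj₁; inj₂)
open import Data.Product using (∃; _×_; _,_; map₂)
open import Function.Base using (_∘_)
open import Function.Bundles using (_⇔_; mk⇔; Equivalence)
open import Relation.Nullary using (¬_; does; contradiction)
open import Relation.Nullary.Decidable using (dec-true; dec-false)
open import Relation.Binary.PropositionalEquality
  using (_≡_; _≢_; refl; sym; trans; cong; cong₂; module ≡-Reasoning)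
open import Algebra.Bundles using (Ring; CommutativeMonoid)
open import Algebra.Properties.Semiring.Sum (Ring.semiring +-*-ring)
  using (sum; sum-syntax; sum-cong-≗; sum-replicate-zero; sum-remove;
         ∑-distrib-+; ∑-comm; *-distribˡ-sum; *-distribʳ-sum)
open import Algebra.Properties.Group +-0-group using (∙-cancelˡ)
open import Algebra.Properties.CommutativeSemigroup
  (CommutativeMonoid.commutativeSemigroup +-0-commutativeMonoid) using (xy∙z≈xz∙y)

open ≡-Reasoning
open Equivalence using (to; from)

𝟙 : Bool → ℚ
𝟙 b = if b then 1ℚ else 0ℚ

Σℚ≡∑ : ∀ k (f : Fin k → ℚ) → Σℚ k f ≡ ∑[ i < k ] f i
Σℚ≡∑ zero    f = refl
Σℚ≡∑ (suc k) f = cong (f zero +_) (Σℚ≡∑ k (f ∘ suc))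

ΣBi≡∑ : ∀ m (f : BiArc m → ℚ) → ΣBi m f ≡ ∑[ e < m ] f (inj₁ e) + ∑[ e < m ] f (inj₂ e)
ΣBi≡∑ m f = cong₂ _+_ (Σℚ≡∑ m (f ∘ inj₁)) (Σℚ≡∑ m (f ∘ inj₂))

∑-supported-at : ∀ {k} (t : Fin k → ℚ) i → (∀ j → j ≢ i → t j ≡ 0ℚ) → ∑[ j < k ] t j ≡ t i
∑-supported-at {suc k} t i t≡0 = begin
  ∑[ j < suc k ] t j        ≡⟨ sum-remove t ⟩
  t i + sum (removeAt t i)  ≡⟨ cong (t i +_) (sum-cong-≗ (λ j → t≡0 _ (punchInᵢ≢i i j))) ⟩
  t i + ∑[ j < k ] 0ℚ       ≡⟨ cong (t i +_) (sum-replicate-zero k) ⟩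
  t i + 0ℚ                  ≡⟨ +-identityʳ (t i) ⟩
  t i                       ∎

∑-*-if-≟ : ∀ {n} (g : Fin n → ℚ) x a →
  ∑[ v < n ] (g v * (if does (x ≟ v) then a else 0ℚ)) ≡ g x * a
∑-*-if-≟ {n} g x a = begin
  ∑[ v < n ] (g v * (if does (x ≟ v) then a else 0ℚ))  ≡⟨ ∑-supported-at _ x off-x ⟩
  g x * (if does (x ≟ x) then a else 0ℚ)               ≡⟨ cong (λ b → g x * (if b then a else 0ℚ)) (dec-true (x ≟ x) refl) ⟩
  g x * a                                              ∎
  where
  off-x : ∀ v → v ≢ x → g v * (if does (x ≟ v) then a else 0ℚ) ≡ 0ℚ
  off-x v v≢x rewrite dec-false (x ≟ v) (v≢x ∘ sym) = *-zeroʳ (g v)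

∑-𝟙-disjoint : ∀ {k} (b : Fin k → Bool) {a} → (a ≡ true ⇔ ∃ λ i → b i ≡ true) →
  (∀ i j → i ≢ j → ¬ (b i ≡ true × b j ≡ true)) → ∑[ i < k ] 𝟙 (b i) ≡ 𝟙 a
∑-𝟙-disjoint {k} b {false} a⇔∃b _ = begin
  ∑[ i < k ] 𝟙 (b i)  ≡⟨ sum-cong-≗ (λ i → cong 𝟙 (¬-not (λ bᵢ → contradiction (from a⇔∃b (i , bᵢ)) λ ()))) ⟩
  ∑[ i < k ] 0ℚ       ≡⟨ sum-replicate-zero k ⟩
  0ℚ                  ∎
∑-𝟙-disjoint {k} b {true} a⇔∃b disjoint with to a⇔∃b refl
... | i , bᵢ = begin
  ∑[ j < k ] 𝟙 (b j)  ≡⟨ ∑-supported-at _ i (λ j j≢i → cong 𝟙 (¬-not (λ bⱼ → disjoint j i j≢i (bⱼ , bᵢ)))) ⟩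
  𝟙 (b i)             ≡⟨ cong 𝟙 bᵢ ⟩
  1ℚ                  ∎

∑-*-incidence : ∀ {n k} (g : Fin n → ℚ) (end : Fin k → Fin n) (w : Fin k → ℚ) →
  ∑[ v < n ] (g v * ∑[ a < k ] (if does (end a ≟ v) then w a else 0ℚ)) ≡ ∑[ a < k ] (g (end a) * w a)
∑-*-incidence {n} {k} g end w = begin
  ∑[ v < n ] (g v * ∑[ a < k ] w-at v a)    ≡⟨ sum-cong-≗ (λ v → *-distribˡ-sum (g v) (w-at v)) ⟩
  ∑[ v < n ] ∑[ a < k ] (g v * w-at v a)    ≡⟨ ∑-comm (λ v a → g v * w-at v a) ⟩
  ∑[ a < k ] ∑[ v < n ] (g v * w-at v a)    ≡⟨ sum-cong-≗ (λ a → ∑-*-if-≟ g (end a) (w a)) ⟩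
  ∑[ a < k ] (g (end a) * w a)              ∎
  where
  w-at : Fin n → Fin k → ℚ
  w-at v a = if does (end a ≟ v) then w a else 0ℚ

ΣBi-*-incidence : ∀ {n m} (g : Fin n → ℚ) (end : BiArc m → Fin n) (z : BiArc m → ℚ) →
  ∑[ v < n ] (g v * ΣBi m (λ a → if does (end a ≟ v) then z a else 0ℚ)) ≡ ΣBi m (λ a → g (end a) * z a)
ΣBi-*-incidence {n} {m} g end z = begin
  ∑[ v < n ] (g v * ΣBi m (z-at v))
    ≡⟨ sum-cong-≗ (λ v → trans (cong (g v *_) (ΣBi≡∑ m (z-at v))) (*-distribˡ-+ (g v) _ _)) ⟩
  ∑[ v < n ] (g v * ∑[ e < m ] z-at v (inj₁ e) + g v * ∑[ e < m ] z-at v (inj₂ e))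
    ≡⟨ ∑-distrib-+ (λ v → g v * ∑[ e < m ] z-at v (inj₁ e)) (λ v → g v * ∑[ e < m ] z-at v (inj₂ e)) ⟩
  ∑[ v < n ] (g v * ∑[ e < m ] z-at v (inj₁ e)) + ∑[ v < n ] (g v * ∑[ e < m ] z-at v (inj₂ e))
    ≡⟨ cong₂ _+_ (∑-*-incidence g (end ∘ inj₁) (z ∘ inj₁)) (∑-*-incidence g (end ∘ inj₂) (z ∘ inj₂)) ⟩
  ∑[ e < m ] (g (end (inj₁ e)) * z (inj₁ e)) + ∑[ e < m ] (g (end (inj₂ e)) * z (inj₂ e))
    ≡⟨ sym (ΣBi≡∑ m (λ a → g (end a) * z a)) ⟩
  ΣBi m (λ a → g (end a) * z a)
    ∎
  where
  z-at : Fin n → BiArc m → ℚ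
  z-at v a = if does (end a ≟ v) then z a else 0ℚ

circulation-conserves-potential : ∀ {n m} (D : Digraph n m) z → IsCirculation D z → (g : Fin n → ℚ) →
  ΣBi m (λ a → g (biHead D a) * z a) ≡ ΣBi m (λ a → g (biTail D a) * z a)
circulation-conserves-potential {n} {m} D z circ g = begin
  ΣBi m (λ a → g (biHead D a) * z a)        ≡⟨ sym (ΣBi-*-incidence g (biHead D) z) ⟩
  ∑[ v < n ] (g v * inflow D z v)           ≡⟨ sum-cong-≗ (λ v → cong (g v *_) (circ v)) ⟩
  ∑[ v < n ] (g v * outflow D z v)          ≡⟨ ΣBi-*-incidence g (biTail D) z ⟩
  ΣBi m (λ a → g (biTail D a) * z a)        ∎

crosses : ∀ {n m} → Digraph n m → NodeSet n → Fin m → Bool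
crosses D Z e = Z (tail D e) xor Z (head D e)

xor≡true⇔ : ∀ {a b} → ((a ≡ true × b ≡ false) ⊎ (a ≡ false × b ≡ true)) ⇔ (a xor b ≡ true)
xor≡true⇔ = mk⇔ to′ from′
  where
  to′ : ∀ {a b} → (a ≡ true × b ≡ false) ⊎ (a ≡ false × b ≡ true) → a xor b ≡ true
  to′ (inj₁ (refl , refl)) = refl
  to′ (inj₂ (refl , refl)) = refl
  from′ : ∀ {a b} → a xor b ≡ true → (a ≡ true × b ≡ false) ⊎ (a ≡ false × b ≡ true)
  from′ {true}  {false} _ = inj₁ (refl , refl)
  from′ {false} {true}  _ = inj₂ (refl , refl)

𝟙-xor : ∀ a b → (b ≡ true → a ≡ true) → 𝟙 a ≡ 𝟙 b + 𝟙 (a xor b)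
𝟙-xor true  true  _   = refl
𝟙-xor true  false _   = refl
𝟙-xor false false _   = refl
𝟙-xor false true  b⇒a = contradiction (b⇒a refl) λ ()

module _ {n m} (D : Digraph n m) (Z : NodeSet n) (no-entry : NoArcEnters D Z) where

  ∑-tail∈-split : (w : Fin m → ℚ) →
    ∑[ e < m ] (𝟙 (Z (tail D e)) * w e)
      ≡ ∑[ e < m ] (𝟙 (Z (head D e)) * w e) + ∑[ e < m ] (𝟙 (crosses D Z e) * w e)
  ∑-tail∈-split w = trans
    (sum-cong-≗ (λ e → trans (cong (_* w e) (𝟙-xor _ _ (no-entry e)))
                             (*-distribʳ-+ (w e) (𝟙 (Z (head D e))) (𝟙 (crosses D Z e)))))
    (∑-distrib-+ (λ e → 𝟙 (Z (head D e)) * w e) (λ e → 𝟙 (crosses D Z e) * w e))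

  dicut-balanced : ∀ z → IsCirculation D z →
    ∑[ e < m ] (𝟙 (crosses D Z e) * z (inj₁ e)) ≡ ∑[ e < m ] (𝟙 (crosses D Z e) * z (inj₂ e))
  dicut-balanced z circ = ∙-cancelˡ (P⁺ + P⁻) C⁺ C⁻ (begin
    (P⁺ + P⁻) + C⁺                               ≡⟨ xy∙z≈xz∙y P⁺ P⁻ C⁺ ⟩
    (P⁺ + C⁺) + P⁻                               ≡⟨ cong (_+ P⁻) (sym (∑-tail∈-split (z ∘ inj₁))) ⟩
    ∑[ e < m ] (g (tail D e) * z (inj₁ e)) + P⁻  ≡⟨ sym (ΣBi≡∑ m (λ a → g (biTail D a) * z a)) ⟩
    ΣBi m (λ a → g (biTail D a) * z a)           ≡⟨ sym (circulation-conserves-potential D z circ g) ⟩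
    ΣBi m (λ a → g (biHead D a) * z a)           ≡⟨ ΣBi≡∑ m (λ a → g (biHead D a) * z a) ⟩
    P⁺ + ∑[ e < m ] (g (tail D e) * z (inj₂ e))  ≡⟨ cong (P⁺ +_) (∑-tail∈-split (z ∘ inj₂)) ⟩
    P⁺ + (P⁻ + C⁻)                               ≡⟨ sym (+-assoc P⁺ P⁻ C⁻) ⟩
    (P⁺ + P⁻) + C⁻                               ∎)
    where
    g : Fin n → ℚ
    g = 𝟙 ∘ Z
    P⁺ P⁻ C⁺ C⁻ : ℚ
    P⁺ = ∑[ e < m ] (g (head D e) * z (inj₁ e))
    P⁻ = ∑[ e < m ] (g (head D e) * z (inj₂ e))
    C⁺ = ∑[ e < m ] (𝟙 (crosses D Z e) * z (inj₁ e))
    C⁻ = ∑[ e < m ] (𝟙 (crosses D Z e) * z (inj₂ e))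

reversed-arcs-balanced : ∀ {n m} (D : Digraph n m) {r} → IsDicutEquivalentReorientation D r →
  ∀ z → IsCirculation D z → ∑[ e < m ] (𝟙 (r e) * z (inj₁ e)) ≡ ∑[ e < m ] (𝟙 (r e) * z (inj₂ e))
reversed-arcs-balanced {m = m} D {r} (k , Zs , no-entry , disjoint , reversed⇔cut) z circ = begin
  ∑[ e < m ] (𝟙 (r e) * z (inj₁ e))                       ≡⟨ split-by-dicuts (z ∘ inj₁) ⟩
  ∑[ i < k ] ∑[ e < m ] (𝟙 (cut i e) * z (inj₁ e))        ≡⟨ sum-cong-≗ (λ i → dicut-balanced D (Zs i) (no-entry i) z circ) ⟩
  ∑[ i < k ] ∑[ e < m ] (𝟙 (cut i e) * z (inj₂ e))        ≡⟨ split-by-dicuts (z ∘ inj₂) ⟨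
  ∑[ e < m ] (𝟙 (r e) * z (inj₂ e))                       ∎
  where
  cut : Fin k → Fin m → Bool
  cut i = crosses D (Zs i)

  𝟙-reversed : ∀ e → ∑[ i < k ] 𝟙 (cut i e) ≡ 𝟙 (r e)
  𝟙-reversed e = ∑-𝟙-disjoint (λ i → cut i e)
    (mk⇔ (map₂ (to xor≡true⇔) ∘ to (reversed⇔cut e)) (from (reversed⇔cut e) ∘ map₂ (from xor≡true⇔)))
    (λ i j i≢j (cutᵢ , cutⱼ) → disjoint i j i≢j e (from xor≡true⇔ cutᵢ , from xor≡true⇔ cutⱼ))

  split-by-dicuts : (w : Fin m → ℚ) →
    ∑[ e < m ] (𝟙 (r e) * w e) ≡ ∑[ i < k ] ∑[ e < m ] (𝟙 (cut i e) * w e)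
  split-by-dicuts w = begin
    ∑[ e < m ] (𝟙 (r e) * w e)                     ≡⟨ sum-cong-≗ (λ e → cong (_* w e) (𝟙-reversed e)) ⟨
    ∑[ e < m ] (∑[ i < k ] 𝟙 (cut i e) * w e)      ≡⟨ sum-cong-≗ (λ e → *-distribʳ-sum (w e) (λ i → 𝟙 (cut i e))) ⟩
    ∑[ e < m ] ∑[ i < k ] (𝟙 (cut i e) * w e)      ≡⟨ ∑-comm (λ e i → 𝟙 (cut i e) * w e) ⟩
    ∑[ i < k ] ∑[ e < m ] (𝟙 (cut i e) * w e)      ∎

charA'-complement : ∀ {m} (r : Fin m → Bool) e → charA' r (inj₁ e) + charA' r (inj₂ e) ≡ 1ℚ
charA'-complement r e with r e
... | true  = refl
... | false = refl

charA·≡ : ∀ {m} (r : Fin m → Bool) (z : BiArc m → ℚ) →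
  charA · z ≡ ∑[ e < m ] (charA' r (inj₁ e) * z (inj₁ e)) + ∑[ e < m ] (𝟙 (r e) * z (inj₁ e))
charA·≡ {m} r z = begin
  charA · z
    ≡⟨ ΣBi≡∑ m (λ a → charA a * z a) ⟩
  ∑[ e < m ] (1ℚ * z (inj₁ e)) + ∑[ e < m ] (0ℚ * z (inj₂ e))
    ≡⟨ cong₂ _+_ (sum-cong-≗ split) (trans (sum-cong-≗ (λ e → *-zeroˡ (z (inj₂ e)))) (sum-replicate-zero m)) ⟩
  ∑[ e < m ] (charA' r (inj₁ e) * z (inj₁ e) + 𝟙 (r e) * z (inj₁ e)) + 0ℚ
    ≡⟨ +-identityʳ _ ⟩
  ∑[ e < m ] (charA' r (inj₁ e) * z (inj₁ e) + 𝟙 (r e) * z (inj₁ e))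
    ≡⟨ ∑-distrib-+ (λ e → charA' r (inj₁ e) * z (inj₁ e)) (λ e → 𝟙 (r e) * z (inj₁ e)) ⟩
  ∑[ e < m ] (charA' r (inj₁ e) * z (inj₁ e)) + ∑[ e < m ] (𝟙 (r e) * z (inj₁ e))
    ∎
  where
  split : ∀ e → 1ℚ * z (inj₁ e) ≡ charA' r (inj₁ e) * z (inj₁ e) + 𝟙 (r e) * z (inj₁ e)
  split e = trans (cong (_* z (inj₁ e)) (sym (charA'-complement r e)))
                  (*-distribʳ-+ (z (inj₁ e)) (charA' r (inj₁ e)) (𝟙 (r e)))

claim5p1 : {n m : ℕ} (D : Digraph n m) → Loopless D → WeaklyConnected D → 2 ≤ n →
    (r : Fin m → Bool) → IsDicutEquivalentReorientation D r →
    (z : BiArc m → ℚ) → NonNegative z → IsCirculation D z →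
    charA · z ≡ charA' r · z
claim5p1 {m = m} D _ _ _ r reorientation z _ circ = begin
  charA · z
    ≡⟨ charA·≡ r z ⟩
  ∑[ e < m ] (charA' r (inj₁ e) * z (inj₁ e)) + ∑[ e < m ] (𝟙 (r e) * z (inj₁ e))
    ≡⟨ cong (∑[ e < m ] (charA' r (inj₁ e) * z (inj₁ e)) +_) (reversed-arcs-balanced D reorientation z circ) ⟩
  ∑[ e < m ] (charA' r (inj₁ e) * z (inj₁ e)) + ∑[ e < m ] (𝟙 (r e) * z (inj₂ e))
    ≡⟨ ΣBi≡∑ m (λ a → charA' r a * z a) ⟨
  charA' r · z
    ∎
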